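{- Let $\mathcal{G}\subseteq\mathbb{R}^n$ be a sub-module of the $\mathbb{Z}$-module $\mathbb{R}^n$, $\mathcal{S}\subseteq\mathcal{G}$ finite, $X\subseteq\mathcal{S}$ and $\overline X=\mathcal{S}\setminus X$, and let $\mathcal{C}$ be a chamfer mask with weighted distance $d=d_{\mathcal{C}}$. Suppose every border point of $\mathcal{S}$ belongs to $\overline X$. Then for all $p\in X$ and $q\in\overline X$ such that $d(p,\overline X)=d(p,q)$, all points of any shortest path between $p$ and $q$ are in $\mathcal{S}$.
   Context: A sub-module of the $\mathbb{Z}$-module $\mathbb{R}^n$ is an additive subgroup of $\mathbb{R}^n$. A chamfer mask is a finite set $\mathcal{C}=\{(\vec v_k,w_k)\}\subseteq\mathcal{G}\times\mathbb{Z}$ containing a basis of the $\mathbb{Z}$-module $\mathcal{G}$ among its vectors, with $w_k>0$ and $\vec v_k\ne0$, and symmetric ($(\vec v,w)\in\mathcal{C}\Rightarrow(-\vec v,w)\in\mathcal{C}$). A path from $x$ to $y$ is an ordered sequence $\vec u_1,\dots,\vec u_l$ of vectors of $\mathcal{C}$ with $x+\vec u_1+\dots+\vec u_l=y$; its points are $x+\vec u_1+\dots+\vec u_j$, $j=0,\dots,l$; its cost is the sum of the weights of the $\vec u_j$. $d_{\mathcal{C}}(x,y)$ is the minimum cost of a path from $x$ to $y$ (paths in $\mathcal{G}$), and a shortest path is one whose cost equals $d_{\mathcal{C}}(x,y)$. For $x\in\mathcal{S}$, $d(x,\overline X)=\min_{y\in\overline X}d(x,y)$. A point $x\in\mathcal{S}$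 is a border point if there is a vector $\vec v$ of $\mathcal{C}$ with $x+\vec v\notin\mathcal{S}$. -}

module Defs where

open import Level using (0ℓ)
open import Algebra.Bundles using (AbelianGroup)
open import Data.Nat using (ℕ; zero; suc; _<_) renaming (_+_ to _+ℕ_)
open import Data.Integer using (ℤ; +_; -[1+_])
open import Data.List using (List; []; _∷_; length)
open import Data.List.Membership.Propositional using (_∈_)
open import Data.Vec using (Vec; []; _∷_)
open import Data.Vec.Relation.Unary.All as VAll using ()
open import Data.Product using (Σ; ∃; _×_; _,_; proj₁)
open import Relation.Nullary using (¬_)
open import Relation.Binary.PropositionalEquality using (_≡_)

-- All notions are relative to an abelian group 𝔾 (= a ℤ-module),
-- whose carrier plays the role of the sub-module 𝒢 of ℝⁿ.
module Chamfer (𝔾 : AbelianGroup 0ℓ 0ℓ) where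
  open AbelianGroup 𝔾 renaming (Carrier to G; _∙_ to _+ᴳ_; ε to 0ᴳ; _⁻¹ to -ᴳ_)

  _·ℕ_ : ℕ → G → G
  zero  ·ℕ g = 0ᴳ
  suc n ·ℕ g = g +ᴳ (n ·ℕ g)

  _·_ : ℤ → G → G
  (+ n)    · g = n ·ℕ g
  -[1+ n ] · g = -ᴳ (suc n ·ℕ g)

  linComb : ∀ {k} → Vec ℤ k → Vec G k → G
  linComb []       []       = 0ᴳ
  linComb (c ∷ cs) (b ∷ bs) = (c · b) +ᴳ linComb cs bs

  IsBasis : ∀ {k} → Vec G k → Set
  IsBasis bs = (∀ g → ∃ λ cs → linComb cs bs ≡ g)
             × (∀ cs → linComb cs bs ≡ 0ᴳ → VAll.All (_≡ + 0) cs)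

  Mask : Set
  Mask = List (G × ℤ)

  record IsChamferMask (C : Mask) : Set where
    field
      positive  : ∀ {v w} → (v , w) ∈ C → Data.Integer._<_ (+ 0) w
      nonzero   : ∀ {v w} → (v , w) ∈ C → ¬ (v ≡ 0ᴳ)
      symmetric : ∀ {v w} → (v , w) ∈ C → (-ᴳ v , w) ∈ C
      basisSize : ℕ
      basis     : Vec G basisSize
      basisInC  : VAll.All (λ b → ∃ λ w → (b , w) ∈ C) basis
      isBasis   : IsBasis basis

  data Path (C : Mask) : G → G → Set where
    []  : ∀ {x} → Path C x x
    _∷_ : ∀ {x y v w} → (v , w) ∈ C → Path C (x +ᴳ v) y → Path C x y

  cost : ∀ {C x y} → Path C x y → ℤ
  cost []                   = + 0
  cost (_∷_ {w = w} _ rest) = w Data.Integer.+ cost rest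

  AllPoints : ∀ {C x y} → (G → Set) → Path C x y → Set
  AllPoints {x = x} P []         = P x
  AllPoints {x = x} P (_ ∷ rest) = P x × AllPoints P rest

  IsDist : Mask → G → G → ℤ → Set
  IsDist C x y n = (Σ (Path C x y) λ π → cost π ≡ n)
                 × (∀ (π : Path C x y) → Data.Integer._≤_ n (cost π))

  IsDistToSet : Mask → G → (G → Set) → ℤ → Set
  IsDistToSet C x A n = (∃ λ y → A y × Σ (Path C x y) λ π → cost π ≡ n)
                      × (∀ y → A y → ∀ (π : Path C x y) → Data.Integer._≤_ n (cost π))

  IsShortestPath : ∀ {C x y} → Path C x y → Set
  IsShortestPath {C} {x} {y} π = IsDist C x y (cost π)

  _∈S_ : G → List G → Set
  x ∈S S = x ∈ S

  IsBorderPoint : Mask → List G → G → Set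
  IsBorderPoint C S x = x ∈ S × ∃ λ v → ∃ λ w → (v , w) ∈ C × ¬ ((x +ᴳ v) ∈ S)

  Compl : List G → (G → Set) → G → Set
  Compl S X y = y ∈ S × ¬ X y

-- Walk along the shortest path π from p to q carrying the invariant "the cost of the rest of π
-- is at most the distance from the current point to X̄".  While the rest of π is nonempty its
-- cost is positive, so the current point is not in X̄; as border points lie in X̄, the current
-- point (in S by induction) is not a border point, hence its successor on π is again in S.
module Submission where

open import Defs
open import Level using (0ℓ)
open import Algebra.Bundles using (AbelianGroup)
open import Data.Integer using (ℤ; +_; _+_; _≤_; _<_)
open import Data.Integer.Properties
  using (_≟_; ≤-refl; ≤-trans; <⇒≤; <⇒≱; ≮⇒≥; +-monoʳ-<; +-mono-≤; +-mono-<-≤)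
open import Data.List using (List)
open import Data.List.Membership.Propositional using (_∈_)
import Data.List.Membership.DecPropositional as DecMembership
open import Data.Vec using (Vec)
open import Data.Vec.Properties using (≡-dec)
open import Data.Product using (_×_; _,_; proj₁; proj₂)
open import Relation.Nullary using (¬_; yes; no; contradiction)
open import Relation.Binary.Definitions using (DecidableEquality)
open import Relation.Binary.PropositionalEquality using (_≡_; refl; sym; cong; module ≡-Reasoning)

+-cancelˡ-≤ : ∀ i {j k} → i + j ≤ i + k → j ≤ k
+-cancelˡ-≤ i i+j≤i+k = ≮⇒≥ λ k<j → <⇒≱ (+-monoʳ-< i k<j) i+j≤i+k

module _ (𝔾 : AbelianGroup 0ℓ 0ℓ) where
  open AbelianGroup 𝔾 using () renaming (Carrier to G; _∙_ to _+ᴳ_)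
  open Chamfer 𝔾

  -- A successor x + v is shown to lie in S by deciding membership, which needs decidable
  -- equality on G; it comes from the integer coordinates in the basis.
  module _ {k} {bs : Vec G k} (basis : IsBasis bs) where

    coordinates : G → Vec ℤ k
    coordinates g = proj₁ (proj₁ basis g)

    coordinates-injective : ∀ {g h} → coordinates g ≡ coordinates h → g ≡ h
    coordinates-injective {g} {h} same = begin
      g                         ≡⟨ sym (proj₂ (proj₁ basis g)) ⟩
      linComb (coordinates g) bs ≡⟨ cong (λ cs → linComb cs bs) same ⟩
      linComb (coordinates h) bs ≡⟨ proj₂ (proj₁ basis h) ⟩
      h                         ∎
      where open ≡-Reasoning

    basis⇒≡-dec : DecidableEquality G
    basis⇒≡-dec g h with ≡-dec _≟_ (coordinates g) (coordinates h)
    ... | yes same  = yes (coordinates-injective same)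
    ... | no differ = no λ { refl → differ refl }

  module _ {C : Mask} (A : G → Set) where

    _≤dist_ : ℤ → G → Set
    k ≤dist x = ∀ y → A y → (τ : Path C x y) → k ≤ cost τ

    ≤dist-step : ∀ {x v w k} → (v , w) ∈ C → (w + k) ≤dist x → k ≤dist (x +ᴳ v)
    ≤dist-step {w = w} e bound y Ay τ = +-cancelˡ-≤ w (bound y Ay (e ∷ τ))

    ≤dist-∉ : ∀ {x k} → + 0 < k → k ≤dist x → ¬ A x
    ≤dist-∉ {x} 0<k bound Ax = <⇒≱ 0<k (bound x Ax [])

  module _ {C : Mask} (M : IsChamferMask C) where
    open IsChamferMask M

    cost-nonneg : ∀ {x y} (π : Path C x y) → + 0 ≤ cost π
    cost-nonneg []      = ≤-refl
    cost-nonneg (e ∷ π) = +-mono-≤ (<⇒≤ (positive e)) (cost-nonneg π)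

    cost-∷-pos : ∀ {x y v w} (e : (v , w) ∈ C) (π : Path C (x +ᴳ v) y) → + 0 < cost (e ∷ π)
    cost-∷-pos e π = +-mono-<-≤ (positive e) (cost-nonneg π)

    module _ (S : List G) (A : G → Set) (border⊆A : ∀ x → IsBorderPoint C S x → A x) where
      open DecMembership (basis⇒≡-dec isBasis) using (_∈?_)

      interior-step : ∀ {x v w} → (v , w) ∈ C → x ∈ S → ¬ A x → (x +ᴳ v) ∈ S
      interior-step {x} {v} {w} e x∈S x∉A with (x +ᴳ v) ∈? S
      ... | yes x+v∈S = x+v∈S
      ... | no  x+v∉S = contradiction (border⊆A x (x∈S , v , w , e , x+v∉S)) x∉A

      allPoints-∈ : ∀ {x y} (π : Path C x y) → x ∈ S → _≤dist_ A (cost π) x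
                  → AllPoints (_∈ S) π
      allPoints-∈ []      x∈S _     = x∈S
      allPoints-∈ (e ∷ π) x∈S bound =
        x∈S , allPoints-∈ π (interior-step e x∈S (≤dist-∉ A (cost-∷-pos e π) bound))
                            (≤dist-step A e bound)

lemma3p2 : (𝔾 : AbelianGroup 0ℓ 0ℓ)
           → (∀ {x y} → AbelianGroup._≈_ 𝔾 x y → x ≡ y)
           → (C : Chamfer.Mask 𝔾) → Chamfer.IsChamferMask 𝔾 C
           → (S : List (AbelianGroup.Carrier 𝔾))
           → (X : AbelianGroup.Carrier 𝔾 → Set)
           → (∀ x → X x → x ∈ S)
           → (∀ x → Chamfer.IsBorderPoint 𝔾 C S x → Chamfer.Compl 𝔾 S X x)
           → ∀ p q (n : ℤ) → X p → Chamfer.Compl 𝔾 S X q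
           → Chamfer.IsDistToSet 𝔾 C p (Chamfer.Compl 𝔾 S X) n
           → Chamfer.IsDist 𝔾 C p q n
           → (π : Chamfer.Path 𝔾 C p q) → Chamfer.IsShortestPath 𝔾 π
           → Chamfer.AllPoints 𝔾 (λ x → x ∈ S) π
lemma3p2 𝔾 _ C M S X X⊆S border⊆X̄ p q n Xp _ (_ , n≤dist) ((π₀ , cost-π₀) , _) π (_ , π-shortest) =
  allPoints-∈ 𝔾 M S X̄ border⊆X̄ π (X⊆S p Xp) cost-π≤dist
  where
  open Chamfer 𝔾 using (cost; Compl)
  X̄ : AbelianGroup.Carrier 𝔾 → Set
  X̄ = Compl S X
  cost-π≤n : cost π ≤ n
  cost-π≤n rewrite sym cost-π₀ = π-shortest π₀
  cost-π≤dist : _≤dist_ 𝔾 X̄ (cost π) p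
  cost-π≤dist y X̄y τ = ≤-trans cost-π≤n (n≤dist y X̄y τ)
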